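{- Every finite subset of $\mathcal D$ is definable: for every finite $u\subseteq\mathcal D$ there is a finite sum $\mathbb M$ of closed terms of the $\partial_0\lambda$-calculus with tests such that $\llbracket\mathbb M\rrbracket=u$.
   Context: Syntax of the $\partial_0\lambda$-calculus with tests: terms $M::=x\mid\lambda x.M\mid MP\mid\bar\tau(V)$, bags $P::=[L_1,\dots,L_k]$, tests $V::=\tau[L_1,\dots,L_k]$ (finite multisets of terms, $k\ge0$), up to $\alpha$-equivalence; sums are finite formal sums with idempotent addition. The model $\mathcal D$. $\mathcal M_f(S)$ = finite multisets over $S$. $D_0=\emptyset$, $D_{n+1}$ = $\mathbb N$-indexed sequences $(a_1,a_2,\dots)$ of elements of $\mathcal M_f(D_n)$ with all but finitely many empty; $\mathcal D=\bigcup_nD_n$; $a::(a_1,a_2,\dots):=(a,a_1,a_2,\dots)$; $*:=([\,],[\,],\dots)$; $\uplus$ on tuples is componentwise. For a repetition-free list $\vec x=x_1,\dots,x_n$ containing the free variables: $\llbracket x_i\rrbracket_{\vec x}=\{(([\,],\dots,[\alpha],\dots,[\,]),\alpha):\alpha\in\mathcal D\}$ ($[\alpha]$ in position $i$); $\llbracket\lambda y.M\rrbracket_{\vec x}=\{(\vec a,b::\alpha):((\vec a,b),\alpha)\in\llbracket M\rrbracket_{\vec x,y}\}$; $\llbracket MP\rrbracket_{\vec x}=\{(\vec a_1\uplus\vec a_2,\alpha):\exists b\,(\vec a_1,b::\alpha)\in\llbracket M\rrbracket_{\vec x},(\vec a_2,b)\in\llbracket P\rrbracket_{\vec x}\}$;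 $\llbracket\bar\tau(V)\rrbracket_{\vec x}=\{(\vec a,*):\vec a\in\llbracket V\rrbracket_{\vec x}\}$; $\llbracket[L_1,\dots,L_k]\rrbracket_{\vec x}=\{(\biguplus_i\vec a_i,[\beta_1,\dots,\beta_k]):(\vec a_i,\beta_i)\in\llbracket L_i\rrbracket_{\vec x}\}$; $\llbracket\tau[L_1,\dots,L_k]\rrbracket_{\vec x}=\{\biguplus_i\vec a_i:(\vec a_i,*)\in\llbracket L_i\rrbracket_{\vec x}\}$; sums are interpreted as unions. For closed terms (empty list) $\llbracket M\rrbracket$ is regarded as a subset of $\mathcal D$. -}

module Defs where

open import Data.Nat using (ℕ; suc)
open import Data.Fin using (Fin)
open import Data.List using (List; []; _∷_; _++_; [_])
open import Data.Vec using (Vec; []; _∷_; replicate; zipWith; _[_]≔_)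

-- Syntax of the ∂₀λ-calculus with tests, in de Bruijn form (terms up to
-- α-equivalence).
-- Bags [L₁,…,Lₖ] and tests τ[L₁,…,Lₖ] are represented by lists of terms
-- (the semantics below does not depend on the order).

data Term (n : ℕ) : Set where
  var : Fin n → Term n
  lam : Term (suc n) → Term n
  app : Term n → List (Term n) → Term n
  tst : List (Term n) → Term n            -- τ̄(τ[L₁,…,Lₖ])

-- An element of D_{n+1} is a sequence of finite multisets
-- of elements of D_n, almost all empty; we represent it by the finite
-- list of its components (trailing components are empty), each multiset
-- being a list.  D₀ = ∅, and 𝒟 = ⋃ D_n is the inductive type below.

data D : Set where
  seq : List (List D) → D

mutual
  data _≈_ : D → D → Set where
    seq : ∀ {as bs} → as ≈s bs → seq as ≈ seq bs

  data _≈s_ : List (List D) → List (List D) → Set where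
    []  : [] ≈s []
    εˡ  : ∀ {as} → as ≈s [] → ([] ∷ as) ≈s []
    εʳ  : ∀ {bs} → [] ≈s bs → [] ≈s ([] ∷ bs)
    _∷_ : ∀ {a b as bs} → a ≈m b → as ≈s bs → (a ∷ as) ≈s (b ∷ bs)

  data _≈m_ : List D → List D → Set where
    []   : [] ≈m []
    cons : ∀ {x y xs ys₁ ys₂} → x ≈ y → xs ≈m (ys₁ ++ ys₂) →
           (x ∷ xs) ≈m (ys₁ ++ y ∷ ys₂)

_∷D_ : List D → D → D
a ∷D seq as = seq (a ∷ as)

star : D
star = seq []

Env : ℕ → Set
Env n = Vec (List D) n

data _≈E_ : ∀ {n} → Env n → Env n → Set where
  []  : [] ≈E []
  _∷_ : ∀ {n a b} {as bs : Env n} → a ≈m b → as ≈E bs → (a ∷ as) ≈E (b ∷ bs)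

emptyEnv : ∀ {n} → Env n
emptyEnv {n} = replicate n []

single : ∀ {n} → Fin n → D → Env n
single i α = emptyEnv [ i ]≔ [ α ]

_⊎E_ : ∀ {n} → Env n → Env n → Env n
_⊎E_ = zipWith _++_

-- Interpretation.  Sem M e α  means  (e , α) ∈ ⟦M⟧ ;
-- SemB P e b  means (e , b) ∈ ⟦P⟧ (b listed in the order of the bag);
-- SemT V e  means  e ∈ ⟦V⟧.

mutual
  data Sem {n : ℕ} : Term n → Env n → D → Set where
    var : ∀ {i e α} → e ≈E single i α → Sem (var i) e α
    lam : ∀ {M a b α β} → Sem M (b ∷ a) α → β ≈ (b ∷D α) → Sem (lam M) a β
    app : ∀ {M P e a₁ a₂ b b' α} → Sem M a₁ (b ∷D α) → SemB P a₂ b' →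
          b ≈m b' → e ≈E (a₁ ⊎E a₂) → Sem (app M P) e α
    tst : ∀ {V e β} → SemT V e → β ≈ star → Sem (tst V) e β

  data SemB {n : ℕ} : List (Term n) → Env n → List D → Set where
    []  : ∀ {e} → e ≈E emptyEnv → SemB [] e []
    cons : ∀ {L Ls e a₁ a₂ β bs} → Sem L a₁ β → SemB Ls a₂ bs →
           e ≈E (a₁ ⊎E a₂) → SemB (L ∷ Ls) e (β ∷ bs)

  data SemT {n : ℕ} : List (Term n) → Env n → Set where
    []  : ∀ {e} → e ≈E emptyEnv → SemT [] e
    cons : ∀ {L Ls e a₁ a₂} → Sem L a₁ star → SemT Ls a₂ →
           e ≈E (a₁ ⊎E a₂) → SemT (L ∷ Ls) e

⟦_⟧ : Term 0 → D → Set
⟦ M ⟧ α = Sem M [] α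

-- Each point β = (b₁, …, bₖ, [], …) of 𝒟 is defined by a closed term ⌜β⌝ with ⟦⌜β⌝⟧ = {β}, so a
-- finite set is defined by the sum of the terms of its points.  Take
--   ⌜β⌝ = λx₁…λxₖ. τ̄(τ[T(x₁,b₁), …, T(xₖ,bₖ)]),     T(x,b) = τ̄(τ[U(x,γ) | γ ∈ b]),
--   U(x,(c₁,…,cₗ,[],…)) = τ̄(τ[x ⌜c₁⌝ ⋯ ⌜cₗ⌝]),      ⌜c⌝ = [⌜γ⌝ | γ ∈ c].
-- As x ⌜c₁⌝ ⋯ ⌜cₗ⌝ has value * exactly when x is used once at c₁ :: ⋯ :: cₗ :: *, the test
-- U(x,γ) succeeds exactly when x is used once at γ, and T(x,b) exactly when x is used at the
-- multiset b; abstracting x₁,…,xₖ then turns the tests into the value (b₁,…,bₖ,[],…).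

module Submission where

open import Defs
open import Data.Nat using (ℕ; zero; suc)
open import Data.Fin using (Fin; zero; suc)
open import Data.List using (List; []; _∷_; _++_; [_]; map; foldr; foldl)
open import Data.List.Properties using (++-assoc; ++-identityʳ; ∷-injectiveˡ; ∷-injectiveʳ)
open import Data.List.Relation.Binary.Pointwise using (Pointwise; []; _∷_)
import Data.List.Relation.Binary.Pointwise as Pointwise
open import Data.List.Relation.Unary.Any using (Any)
import Data.List.Relation.Unary.Any as Any
open import Data.List.Relation.Unary.Any.Properties using (map⁺; map⁻)
open import Data.Vec using ([]; _∷_; _[_]≔_)
open import Data.Product using (Σ; ∃; _×_; _,_; proj₁; proj₂)
open import Data.Sum using (_⊎_; inj₁; inj₂)
open import Function using (_∘_; id; _⇔_; mk⇔; Equivalence)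
open import Relation.Binary.PropositionalEquality using (_≡_; refl; sym; trans; cong; cong₂; subst; module ≡-Reasoning)

open Equivalence using (to; from)

++-≡-++-∷ : ∀ {X : Set} (A B C₁ : List X) {z : X} {C₂ : List X} → A ++ B ≡ C₁ ++ z ∷ C₂ →
  (∃ λ M → A ≡ C₁ ++ z ∷ M × C₂ ≡ M ++ B) ⊎ (∃ λ M → C₁ ≡ A ++ M × B ≡ M ++ z ∷ C₂)
++-≡-++-∷ [] B C₁ eq = inj₂ (C₁ , refl , eq)
++-≡-++-∷ (a ∷ A) B [] refl = inj₁ (A , refl , refl)
++-≡-++-∷ (a ∷ A) B (c ∷ C₁) eq with ∷-injectiveˡ eq | ++-≡-++-∷ A B C₁ (∷-injectiveʳ eq)
... | refl | inj₁ (M , p , q) = inj₁ (M , cong (a ∷_) p , q)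
... | refl | inj₂ (M , p , q) = inj₂ (M , cong (a ∷_) p , q)

≈m-[]ʳ : ∀ {xs} → xs ≈m [] → xs ≡ []
≈m-[]ʳ p = go p refl
  where
    go : ∀ {xs ys} → xs ≈m ys → ys ≡ [] → xs ≡ []
    go [] _ = refl
    go (cons {ys₁ = []} _ _) ()
    go (cons {ys₁ = _ ∷ _} _ _) ()

≈m-pick : ∀ (Y₁ : List D) {y Y₂ zs} → (Y₁ ++ y ∷ Y₂) ≈m zs →
  ∃ λ Z₁ → ∃ λ z → ∃ λ Z₂ → zs ≡ Z₁ ++ z ∷ Z₂ × y ≈ z × (Y₁ ++ Y₂) ≈m (Z₁ ++ Z₂)
≈m-pick [] (cons r p) = _ , _ , _ , refl , r , p
≈m-pick (w ∷ W) (cons {y = u} {ys₁ = A} {ys₂ = B} r p) with ≈m-pick W p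
... | C₁ , z , C₂ , eq , yz , q with ++-≡-++-∷ A B C₁ eq
...   | inj₁ (M , refl , refl) = C₁ , z , M ++ u ∷ B , ++-assoc C₁ (z ∷ M) (u ∷ B) , yz ,
          subst (_ ≈m_) (++-assoc C₁ M (u ∷ B)) (cons r (subst (_ ≈m_) (sym (++-assoc C₁ M B)) q))
...   | inj₂ (M , refl , refl) = A ++ u ∷ M , z , C₂ , sym (++-assoc A (u ∷ M) (z ∷ C₂)) , yz ,
          subst (_ ≈m_) (sym (++-assoc A (u ∷ M) C₂)) (cons r (subst (_ ≈m_) (++-assoc A M C₂) q))

mutual
  ≈-refl : ∀ x → x ≈ x
  ≈-refl (seq as) = seq (≈s-refl as)

  ≈s-refl : ∀ as → as ≈s as
  ≈s-refl [] = []
  ≈s-refl (a ∷ as) = ≈m-refl a ∷ ≈s-refl as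

  ≈m-refl : ∀ xs → xs ≈m xs
  ≈m-refl [] = []
  ≈m-refl (x ∷ xs) = cons {ys₁ = []} (≈-refl x) (≈m-refl xs)

mutual
  ≈-trans : ∀ {x y z} → x ≈ y → y ≈ z → x ≈ z
  ≈-trans (seq p) (seq q) = seq (≈s-trans p q)

  ≈s-trans : ∀ {as bs cs} → as ≈s bs → bs ≈s cs → as ≈s cs
  ≈s-trans [] q = q
  ≈s-trans (εʳ p) (εˡ q) = []
  ≈s-trans (εʳ p) ([] ∷ q) = εʳ (≈s-trans p q)
  ≈s-trans (εˡ p) [] = εˡ p
  ≈s-trans (εˡ p) (εʳ q) = [] ∷ ≈s-trans p q
  ≈s-trans (r ∷ p) (εˡ q) with ≈m-[]ʳ r
  ... | refl = εˡ (≈s-trans p q)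
  ≈s-trans (r ∷ p) (r' ∷ q) = ≈m-trans r r' ∷ ≈s-trans p q

  ≈m-trans : ∀ {xs ys zs} → xs ≈m ys → ys ≈m zs → xs ≈m zs
  ≈m-trans [] q = q
  ≈m-trans (cons {ys₁ = Y₁} r p) q with ≈m-pick Y₁ q
  ... | Z₁ , z , Z₂ , refl , yz , q' = cons (≈-trans r yz) (≈m-trans p q')

++⁺ : ∀ {xs xs' ys ys'} → xs ≈m xs' → ys ≈m ys' → (xs ++ ys) ≈m (xs' ++ ys')
++⁺ [] q = q
++⁺ {ys' = ys'} (cons {y = y} {ys₁ = A} {ys₂ = B} r p) q =
  subst (_ ≈m_) (sym (++-assoc A (y ∷ B) ys'))
    (cons r (subst (_ ≈m_) (++-assoc A B ys') (++⁺ p q)))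

Pointwise⇒≈m : ∀ {xs ys} → Pointwise _≈_ xs ys → xs ≈m ys
Pointwise⇒≈m [] = []
Pointwise⇒≈m (r ∷ p) = cons {ys₁ = []} r (Pointwise⇒≈m p)

∷D-cong : ∀ {b b' δ δ'} → b ≈m b' → δ ≈ δ' → (b ∷D δ) ≈ (b' ∷D δ')
∷D-cong r (seq p) = seq (r ∷ p)

foldr-∷D-star : ∀ bs → foldr _∷D_ star bs ≡ seq bs
foldr-∷D-star [] = refl
foldr-∷D-star (b ∷ bs) = cong (b ∷D_) (foldr-∷D-star bs)

≈E-refl : ∀ {n} (e : Env n) → e ≈E e
≈E-refl [] = []
≈E-refl (a ∷ e) = ≈m-refl a ∷ ≈E-refl e

infixr 5 _⟨≈E⟩_
_⟨≈E⟩_ : ∀ {n} {e e' e'' : Env n} → e ≈E e' → e' ≈E e'' → e ≈E e''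
[] ⟨≈E⟩ [] = []
(r ∷ p) ⟨≈E⟩ (r' ∷ q) = ≈m-trans r r' ∷ (p ⟨≈E⟩ q)

≡⇒≈E : ∀ {n} {e e' : Env n} → e ≡ e' → e ≈E e'
≡⇒≈E {e = e} refl = ≈E-refl e

⊎E-cong : ∀ {n} {a a' b b' : Env n} → a ≈E a' → b ≈E b' → (a ⊎E b) ≈E (a' ⊎E b')
⊎E-cong [] [] = []
⊎E-cong (r ∷ p) (r' ∷ q) = ++⁺ r r' ∷ ⊎E-cong p q

⊎E-identityˡ : ∀ {n} (e : Env n) → (emptyEnv ⊎E e) ≡ e
⊎E-identityˡ [] = refl
⊎E-identityˡ (a ∷ e) = cong (a ∷_) (⊎E-identityˡ e)

⊎E-identityʳ : ∀ {n} (e : Env n) → (e ⊎E emptyEnv) ≡ e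
⊎E-identityʳ [] = refl
⊎E-identityʳ (a ∷ e) = cong₂ _∷_ (++-identityʳ a) (⊎E-identityʳ e)

_↦_ : ∀ {n} → Fin n → List D → Env n
i ↦ a = emptyEnv [ i ]≔ a

↦-cong : ∀ {n} (i : Fin n) {a b} → a ≈m b → (i ↦ a) ≈E (i ↦ b)
↦-cong {suc n} zero r = r ∷ ≈E-refl (emptyEnv {n})
↦-cong (suc i) r = [] ∷ ↦-cong i r

↦-[] : ∀ {n} (i : Fin n) → i ↦ [] ≡ emptyEnv
↦-[] zero = refl
↦-[] (suc i) = cong ([] ∷_) (↦-[] i)

↦-⊎E : ∀ {n} (i : Fin n) a b → ((i ↦ a) ⊎E (i ↦ b)) ≡ i ↦ (a ++ b)
↦-⊎E {suc n} zero a b = cong ((a ++ b) ∷_) (⊎E-identityˡ (emptyEnv {n}))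
↦-⊎E (suc i) a b = cong ([] ∷_) (↦-⊎E i a b)

spread : ∀ {n m} → (Fin n → Fin m) → Env n → Env m
spread ρ [] = emptyEnv
spread ρ (a ∷ e) = (ρ zero ↦ a) ⊎E spread (ρ ∘ suc) e

spread-emptyEnv : ∀ {n m} (ρ : Fin n → Fin m) → spread ρ emptyEnv ≡ emptyEnv
spread-emptyEnv {zero} ρ = refl
spread-emptyEnv {suc n} ρ = begin
  (ρ zero ↦ []) ⊎E spread (ρ ∘ suc) emptyEnv ≡⟨ cong₂ _⊎E_ (↦-[] (ρ zero)) (spread-emptyEnv (ρ ∘ suc)) ⟩
  emptyEnv ⊎E emptyEnv                       ≡⟨ ⊎E-identityˡ emptyEnv ⟩
  emptyEnv                                   ∎
  where open ≡-Reasoning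

spread-suc : ∀ {n m} (ρ : Fin n → Fin m) e → spread (suc ∘ ρ) e ≡ [] ∷ spread ρ e
spread-suc ρ [] = refl
spread-suc ρ (a ∷ e) = cong ((suc (ρ zero) ↦ a) ⊎E_) (spread-suc (ρ ∘ suc) e)

spread-id : ∀ {n} (e : Env n) → spread id e ≡ e
spread-id [] = refl
spread-id (a ∷ e) = begin
  (zero ↦ a) ⊎E spread suc e                   ≡⟨ cong ((zero ↦ a) ⊎E_) (spread-suc id e) ⟩
  (a ++ []) ∷ (emptyEnv ⊎E spread id e)        ≡⟨ cong₂ _∷_ (++-identityʳ a) (⊎E-identityˡ _) ⟩
  a ∷ spread id e                              ≡⟨ cong (a ∷_) (spread-id e) ⟩
  a ∷ e                                        ∎
  where open ≡-Reasoning

Denotes : ∀ {n} → Term n → Env n → D → Set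
Denotes M e β = ∀ {e' γ} → Sem M e' γ ⇔ (γ ≈ β × e' ≈E e)

Passes : ∀ {n} → Term n → Env n → Set
Passes L e = ∀ {e'} → Sem L e' star ⇔ e' ≈E e

PassAll : ∀ {n} → List (Term n) → Env n → Set
PassAll Ls e = ∀ {e'} → SemT Ls e' ⇔ e' ≈E e

denotes⇒passes : ∀ {n} {L : Term n} {e} → Denotes L e star → Passes L e
denotes⇒passes d = mk⇔ (proj₂ ∘ to d) (λ p → from d (≈-refl star , p))

Values : ∀ {n} → List (Term n) → List D → Set
Values = Pointwise (λ L β → Denotes L emptyEnv β)

passAll-[] : ∀ {n} → PassAll {n} [] emptyEnv
passAll-[] = mk⇔ (λ { ([] p) → p }) []

passAll-∷ : ∀ {n} {L : Term n} {Ls e₁ e₂} → Passes L e₁ → PassAll Ls e₂ → PassAll (L ∷ Ls) (e₁ ⊎E e₂)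
passAll-∷ d ds = mk⇔
  (λ { (cons s t eq) → eq ⟨≈E⟩ ⊎E-cong (to d s) (to ds t) })
  (cons (from d (≈E-refl _)) (from ds (≈E-refl _)))

tst-denotes : ∀ {n} {Ls : List (Term n)} {e} → PassAll Ls e → Denotes (tst Ls) e star
tst-denotes ds = mk⇔
  (λ { (tst t eq) → eq , to ds t })
  (λ (eq , p) → tst (from ds p) eq)

lam-denotes : ∀ {n} {M : Term (suc n)} {a e α} → Denotes M (a ∷ e) α → Denotes (lam M) e (a ∷D α)
lam-denotes {a = a} {e} {α} d = mk⇔
  (λ { (lam s eq) → lam-to (to d s) eq })
  (λ (eq , p) → lam (from d (≈-refl _ , ≈m-refl _ ∷ p)) eq)
  where
    lam-to : ∀ {b e' α' β} → α' ≈ α × (b ∷ e') ≈E (a ∷ e) → β ≈ (b ∷D α') → β ≈ (a ∷D α) × e' ≈E e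
    lam-to (αeq , r ∷ p) eq = ≈-trans eq (∷D-cong r αeq) , p

SemB-Values : ∀ {n} {Ls : List (Term n)} {cs} → Values Ls cs →
  ∀ {e vs} → SemB Ls e vs ⇔ (e ≈E emptyEnv × Pointwise _≈_ vs cs)
SemB-Values [] = mk⇔ (λ { ([] p) → p , [] }) (λ { (p , []) → [] p })
SemB-Values {n} (d ∷ ds) = mk⇔
  (λ { (cons s t eq) → cons-to (to d s) (to (SemB-Values ds) t) eq })
  (λ { (p , r ∷ rs) → cons (from d (r , ≈E-refl _)) (from (SemB-Values ds) (≈E-refl _ , rs))
                        (p ⟨≈E⟩ ≡⇒≈E (sym (⊎E-identityˡ emptyEnv))) })
  where
    cons-to : ∀ {e a₁ a₂ : Env n} {v vs c cs} → v ≈ c × a₁ ≈E emptyEnv →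
              a₂ ≈E emptyEnv × Pointwise _≈_ vs cs → e ≈E (a₁ ⊎E a₂) →
              e ≈E emptyEnv × Pointwise _≈_ (v ∷ vs) (c ∷ cs)
    cons-to (r , p₁) (p₂ , rs) eq = eq ⟨≈E⟩ ⊎E-cong p₁ p₂ ⟨≈E⟩ ≡⇒≈E (⊎E-identityˡ emptyEnv) , r ∷ rs

UsesOnce : ∀ {n} → Term n → (D → Env n) → Set
UsesOnce F f = ∀ {e δ} → Sem F e δ ⇔ e ≈E f δ

var-usesOnce : ∀ {n} (x : Fin n) → UsesOnce (var x) (single x)
var-usesOnce x = mk⇔ (λ { (var p) → p }) var

single-cong : ∀ {n} (x : Fin n) {δ δ'} → δ ≈ δ' → single x δ ≈E single x δ'
single-cong x r = ↦-cong x (cons {ys₁ = []} r [])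

app-usesOnce : ∀ {n} {F : Term n} {f Ls b} → (∀ {δ δ'} → δ ≈ δ' → f δ ≈E f δ') →
  UsesOnce F f → Values Ls b → UsesOnce (app F Ls) (λ δ → f (b ∷D δ))
app-usesOnce {f = f} {b = b} f-cong H ds = mk⇔
  (λ { (app s t eqb eq) → app-to (to H s) (to (SemB-Values ds) t) eqb eq })
  (λ p → app (from H (≈E-refl _)) (from (SemB-Values ds) (≈E-refl _ , Pointwise.refl (≈-refl _)))
              (≈m-refl b) (p ⟨≈E⟩ ≡⇒≈E (sym (⊎E-identityʳ _))))
  where
    app-to : ∀ {e a₁ a₂ b₀ b' δ} → a₁ ≈E f (b₀ ∷D δ) → (a₂ ≈E emptyEnv × Pointwise _≈_ b' b) →
             b₀ ≈m b' → e ≈E (a₁ ⊎E a₂) → e ≈E f (b ∷D δ)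
    app-to {δ = δ} p₁ (p₂ , rs) eqb eq =
      eq ⟨≈E⟩ ⊎E-cong p₁ p₂ ⟨≈E⟩ ≡⇒≈E (⊎E-identityʳ _) ⟨≈E⟩
      f-cong (∷D-cong (≈m-trans eqb (Pointwise⇒≈m rs)) (≈-refl δ))

apps-usesOnce : ∀ {n} {F : Term n} {f Lss bs} → (∀ {δ δ'} → δ ≈ δ' → f δ ≈E f δ') →
  UsesOnce F f → Pointwise Values Lss bs → UsesOnce (foldl app F Lss) (λ δ → f (foldr _∷D_ δ bs))
apps-usesOnce f-cong H [] = H
apps-usesOnce {bs = b ∷ _} f-cong H (ds ∷ dss) =
  apps-usesOnce (f-cong ∘ ∷D-cong (≈m-refl b)) (app-usesOnce f-cong H ds) dss

-- Tests on n variables, taking the renaming ρ into the scope under all the binders: the test on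
-- a variable must be built while its multiset is a structural subterm of β (for termination),
-- but the variable's de Bruijn index is only known under the last binder.
Checks : ℕ → Set
Checks n = ∀ {m} → (Fin n → Fin m) → List (Term m)

mutual
  ⌜_⌝ : ∀ {n} → D → Term n
  ⌜ seq as ⌝ = lamsChecking as (λ _ → [])

  lamsChecking : ∀ {n} → List (List D) → Checks n → Term n
  lamsChecking [] P = tst (P id)
  lamsChecking (a ∷ as) P = lam (lamsChecking as (λ ρ → usedAs (ρ zero) a ∷ P (ρ ∘ suc)))

  usedAs : ∀ {m} → Fin m → List D → Term m
  usedAs x a = tst (usedOnceAsEach x a)

  usedOnceAsEach : ∀ {m} → Fin m → List D → List (Term m)
  usedOnceAsEach x [] = []
  usedOnceAsEach x (β ∷ a) = usedOnceAs x β ∷ usedOnceAsEach x a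

  usedOnceAs : ∀ {m} → Fin m → D → Term m
  usedOnceAs x (seq bs) = tst [ foldl app (var x) (bags bs) ]

  bags : ∀ {m} → List (List D) → List (List (Term m))
  bags [] = []
  bags (b ∷ bs) = bag b ∷ bags bs

  bag : ∀ {m} → List D → List (Term m)
  bag [] = []
  bag (c ∷ b) = ⌜ c ⌝ ∷ bag b

mutual
  ⌜⌝-denotes : ∀ β {n} → Denotes (⌜_⌝ {n} β) emptyEnv β
  ⌜⌝-denotes (seq as) = lamsChecking-denotes as
    (λ ρ → subst (PassAll []) (sym (spread-emptyEnv ρ)) passAll-[])

  lamsChecking-denotes : ∀ as {n} {P : Checks n} {e} →
    (∀ {m} (ρ : Fin n → Fin m) → PassAll (P ρ) (spread ρ e)) → Denotes (lamsChecking as P) e (seq as)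
  lamsChecking-denotes [] {e = e} ds =
    subst (λ e' → Denotes _ e' star) (spread-id e) (tst-denotes (ds id))
  lamsChecking-denotes (a ∷ as) ds = lam-denotes (lamsChecking-denotes as λ ρ →
    passAll-∷ (denotes⇒passes (usedAs-denotes (ρ zero) a)) (ds (ρ ∘ suc)))

  usedAs-denotes : ∀ {m} (x : Fin m) a → Denotes (usedAs x a) (x ↦ a) star
  usedAs-denotes x a = tst-denotes (usedOnceAsEach-passAll x a)

  usedOnceAsEach-passAll : ∀ {m} (x : Fin m) a → PassAll (usedOnceAsEach x a) (x ↦ a)
  usedOnceAsEach-passAll x [] = subst (PassAll []) (sym (↦-[] x)) passAll-[]
  usedOnceAsEach-passAll x (β ∷ a) = subst (PassAll _) (↦-⊎E x [ β ] a)
    (passAll-∷ (denotes⇒passes (usedOnceAs-denotes x β)) (usedOnceAsEach-passAll x a))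

  usedOnceAs-denotes : ∀ {m} (x : Fin m) β → Denotes (usedOnceAs x β) (single x β) star
  usedOnceAs-denotes x (seq bs) = subst (λ e → Denotes (usedOnceAs x (seq bs)) e star) env-eq
    (tst-denotes (passAll-∷ (apps-usesOnce (single-cong x) (var-usesOnce x) (bags-values bs)) passAll-[]))
    where
      env-eq : (single x (foldr _∷D_ star bs) ⊎E emptyEnv) ≡ single x (seq bs)
      env-eq = trans (⊎E-identityʳ _) (cong (single x) (foldr-∷D-star bs))

  bags-values : ∀ {m} bs → Pointwise Values (bags {m} bs) bs
  bags-values [] = []
  bags-values (b ∷ bs) = bag-values b ∷ bags-values bs

  bag-values : ∀ {m} b → Values (bag {m} b) b
  bag-values [] = []
  bag-values (c ∷ b) = ⌜⌝-denotes c ∷ bag-values b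

corollary5p6 : (u : List D) →
    Σ (List (Term 0)) (λ 𝕄 → (α : D) →
      (Any (λ M → ⟦ M ⟧ α) 𝕄 → Any (λ β → α ≈ β) u) ×
      (Any (λ β → α ≈ β) u → Any (λ M → ⟦ M ⟧ α) 𝕄))
corollary5p6 u = map ⌜_⌝ u , λ α →
  Any.map (λ {β} s → proj₁ (to (⌜⌝-denotes β) s)) ∘ map⁻ ,
  map⁺ ∘ Any.map (λ {β} r → from (⌜⌝-denotes β) (r , []))
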